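{- Let $N$ be a positive integer with $\sigma^{**}(N)=3N$, and let $e,f$ be the exponents with $2^e\,\|\,N$ and $3^f\,\|\,N$. Then it is impossible that $e\ge 7$ and $f=3$.
   Context: $\sigma^{**}(N)$ is the sum of the biunitary divisors of $N$, where a divisor $d$ of $N$ is biunitary if the greatest common unitary divisor of $d$ and $N/d$ is $1$ (a divisor $d$ of $m$ being unitary if $\gcd(d,m/d)=1$). $p^a\,\|\,N$ means $p^a\mid N$ and $p^{a+1}\nmid N$. -}

module Defs where

open import Data.Nat using (ℕ; zero; suc; _+_; _*_; _^_; _≡ᵇ_)
open import Data.Nat.Divisibility using (_∣_; _∣?_)
open import Data.Nat.DivMod using (_/_)
open import Data.Nat.GCD using (gcd)
open import Data.List using (List; filterᵇ; upTo; map)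
open import Data.Nat.ListAction using (sum)
open import Data.Bool using (Bool; true; false; _∧_; not)
open import Relation.Nullary.Decidable using (⌊_⌋)
open import Relation.Binary.PropositionalEquality using (_≡_)
open import Data.Product using (_×_)
open import Relation.Nullary using (¬_)

divisors : ℕ → List ℕ
divisors m = filterᵇ (λ d → ⌊ d ∣? m ⌋) (map suc (upTo m))

isUnitaryDivisorᵇ : ℕ → ℕ → Bool
isUnitaryDivisorᵇ d m = ⌊ d ∣? m ⌋ ∧ (gcd d (m / suc (pred' d)) ≡ᵇ 1)
  where
  pred' : ℕ → ℕ
  pred' zero = zero
  pred' (suc k) = k

unitaryDivisors : ℕ → List ℕ
unitaryDivisors m = filterᵇ (λ d → isUnitaryDivisorᵇ d m) (divisors m)

maxList : List ℕ → ℕ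
maxList = Data.List.foldr Data.Nat._⊔_ 0

gcud : ℕ → ℕ → ℕ
gcud a b = maxList (filterᵇ (λ t → isUnitaryDivisorᵇ t b) (unitaryDivisors a))

biunitaryDivisors : ℕ → List ℕ
biunitaryDivisors N =
  filterᵇ (λ d → gcud d (N / suc (predℕ d)) ≡ᵇ 1) (divisors N)
  where
  predℕ : ℕ → ℕ
  predℕ zero = zero
  predℕ (suc k) = k

σ** : ℕ → ℕ
σ** N = sum (biunitaryDivisors N)

_^_∥_ : ℕ → ℕ → ℕ → Set
p ^ a ∥ N = (p Data.Nat.^ a ∣ N) × ¬ (p Data.Nat.^ suc a ∣ N)

{-# OPTIONS --safe #-}
module Submission where

-- Write N = 2^e · 27 · M.  Exact prime powers are unitary divisors, so σ**(2^e · 27) = σ**(2^e) · 40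
-- divides σ**(N) = 3N and 5 ∣ N.  In general, if u is a unitary divisor of N and p ∤ 3u is a prime
-- dividing σ**(u), then p ∣ N and u · p^j is again unitary for p^j ∥ N.  The abundancy σ**(v)/v of a
-- unitary divisor v of N is at most 3, because σ**(w) ≥ w for the cofactor w and σ** is multiplicative.
-- Since σ**(2^e)/2^e ≥ 247/128 for e ≥ 7 and σ**(p^j)/p^j ≥ (1 + p)/p unless j = 2, this forces in turn
-- 5² ∥ N, 13² ∥ N (as 13 ∣ σ**(25) = 26) and 17² ∥ N (as 17 ∣ σ**(169) = 170); but then, with
-- σ**(289) = 290, the unitary divisor 2^e · 27 · 5² · 13² · 17² has abundancy greater than 3.

open import Data.Bool using (Bool; T; T?)
open import Data.Bool.Properties using (T-∧)
open import Data.List using (List; []; _∷_; _++_; map; upTo; filterᵇ; cartesianProductWith)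
open import Data.List.Membership.Propositional using (_∈_)
open import Data.List.Membership.Propositional.Properties
  using (∈-∃++; ∈-filter⁺; ∈-filter⁻; ∈-map⁺; ∈-map⁻; ∈-upTo⁺; ∈-upTo⁻;
         ∈-cartesianProductWith⁺; ∈-cartesianProductWith⁻)
open import Data.List.Properties using (map-∘; map-cong; foldr-preservesᵇ)
open import Data.List.Relation.Binary.Disjoint.Propositional using (Disjoint)
open import Data.List.Relation.Binary.Permutation.Propositional.Properties using (shift; ∈-resp-↭)
open import Data.List.Relation.Binary.Subset.Propositional using (_⊆_)
open import Data.List.Relation.Unary.All as All using (All; []; _∷_)
open import Data.List.Relation.Unary.All.Properties using () renaming (map⁺ to All-map⁺)
open import Data.List.Relation.Unary.Any using (here; there)
open import Data.List.Relation.Unary.Unique.Propositional using (Unique; []; _∷_)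
import Data.List.Relation.Unary.Unique.Propositional.Properties as Unique
open import Data.Nat
  using (ℕ; zero; suc; _+_; _*_; _^_; _≤_; _<_; _≥_; _∸_; NonZero; NonTrivial; z≤n; s≤s; _≟_;
         ≢-nonZero; ≢-nonZero⁻¹; >-nonZero; >-nonZero⁻¹; nonTrivial⇒≢1; nonTrivial⇒n>1)
open import Data.Nat.Coprimality
  using (Coprime; coprime-divisor; gcd≡1⇒coprime; coprime⇒gcd≡1; GCD≡1⇒coprime; 1-coprimeTo)
  renaming (sym to coprime-sym)
open import Data.Nat.Divisibility
open import Data.Nat.GCD
  using (gcd; GCD; gcd[m,n]∣m; gcd[m,n]∣n; gcd-greatest; gcd[m,n]≢0; gcd-GCD; GCD-*)
open import Data.Nat.Induction using (<-wellFounded)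
open import Data.Nat.ListAction using (sum)
open import Data.Nat.ListAction.Properties using (sum-++; sum-↭)
open import Data.Nat.Primality
  using (Prime; prime[2]; prime?; prime⇒irreducible; prime⇒nonTrivial; prime⇒nonZero)
open import Data.Nat.Properties
open import Algebra.Properties.CommutativeSemigroup *-commutativeSemigroup using (interchange)
open import Data.Nat.Tactic.RingSolver using (solve-∀)
open import Data.Product using (_×_; ∃-syntax; ∃₂; _,_; proj₁; proj₂)
open import Data.Sum using (_⊎_; inj₁; inj₂)
open import Function using (_∘_; _⇔_; mk⇔; Equivalence)
open import Induction.WellFounded using (Acc; acc)
open import Relation.Binary.Definitions using (tri<; tri≈; tri>)
open import Relation.Binary.PropositionalEquality
  using (_≡_; _≢_; refl; sym; trans; cong; cong₂; subst; subst₂; module ≡-Reasoning)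
open import Relation.Nullary using (¬_; yes; no; contradiction)
open import Relation.Nullary.Decidable using (from-yes; from-no; toWitness; fromWitness)

open import Defs

open Equivalence using (to; from)

private variable
  A B C : Set
  a b c d j k m n p s t u w x y : ℕ

sum-map-*ˡ : ∀ x ys → sum (map (x *_) ys) ≡ x * sum ys
sum-map-*ˡ x []       = sym (*-zeroʳ x)
sum-map-*ˡ x (y ∷ ys) = trans (cong (x * y +_) (sum-map-*ˡ x ys)) (sym (*-distribˡ-+ x y (sum ys)))

sum-cartesianProductWith-* : ∀ xs ys → sum (cartesianProductWith _*_ xs ys) ≡ sum xs * sum ys
sum-cartesianProductWith-* []       ys = refl
sum-cartesianProductWith-* (x ∷ xs) ys = begin
  sum (map (x *_) ys ++ cartesianProductWith _*_ xs ys)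
    ≡⟨ sum-++ (map (x *_) ys) _ ⟩
  sum (map (x *_) ys) + sum (cartesianProductWith _*_ xs ys)
    ≡⟨ cong₂ _+_ (sum-map-*ˡ x ys) (sum-cartesianProductWith-* xs ys) ⟩
  x * sum ys + sum xs * sum ys
    ≡⟨ *-distribʳ-+ (sum ys) x (sum xs) ⟨
  (x + sum xs) * sum ys
    ∎
  where open ≡-Reasoning

sum-mono-⊆ : ∀ {xs ys} → Unique xs → xs ⊆ ys → sum xs ≤ sum ys
sum-mono-⊆ {[]}     _            _        = z≤n
sum-mono-⊆ {x ∷ xs} (x∉xs ∷ xs!) x∷xs⊆ys with ys₁ , ys₂ , refl ← ∈-∃++ (x∷xs⊆ys (here refl)) =
  begin
    x + sum xs            ≤⟨ +-monoʳ-≤ x (sum-mono-⊆ xs! xs⊆ys₁++ys₂) ⟩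
    x + sum (ys₁ ++ ys₂)  ≡⟨ sum-↭ (shift x ys₁ ys₂) ⟨
    sum (ys₁ ++ x ∷ ys₂)  ∎
  where
  open ≤-Reasoning
  xs⊆ys₁++ys₂ : xs ⊆ ys₁ ++ ys₂
  xs⊆ys₁++ys₂ z∈xs with ∈-resp-↭ (shift x ys₁ ys₂) (x∷xs⊆ys (there z∈xs))
  ... | here refl = contradiction refl (All.lookup x∉xs z∈xs)
  ... | there z∈  = z∈

Unique-map⁺-local : ∀ {f : A → B} {xs} → (∀ {x y} → x ∈ xs → y ∈ xs → f x ≡ f y → x ≡ y) →
              Unique xs → Unique (map f xs)
Unique-map⁺-local _   []           = []
Unique-map⁺-local inj (x∉xs ∷ xs!) =
  All-map⁺ (All.tabulate λ y∈xs fx≡fy → All.lookup x∉xs y∈xs (inj (here refl) (there y∈xs) fx≡fy))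
  ∷ Unique-map⁺-local (λ x∈ y∈ → inj (there x∈) (there y∈)) xs!

Unique-cartesianProductWith⁺-local : ∀ (f : A → B → C) {xs ys} →
  (∀ {w x y z} → w ∈ xs → x ∈ xs → y ∈ ys → z ∈ ys → f w y ≡ f x z → w ≡ x × y ≡ z) →
  Unique xs → Unique ys → Unique (cartesianProductWith f xs ys)
Unique-cartesianProductWith⁺-local f           inj []           ys! = []
Unique-cartesianProductWith⁺-local f {x ∷ xs} {ys} inj (x∉xs ∷ xs!) ys! = Unique.++⁺
  (Unique-map⁺-local (λ y∈ z∈ → proj₂ ∘ inj (here refl) (here refl) y∈ z∈) ys!)
  (Unique-cartesianProductWith⁺-local f (λ w∈ x∈ → inj (there w∈) (there x∈)) xs! ys!)
  disjoint
  where
  disjoint : Disjoint (map (f x) ys) (cartesianProductWith f xs ys)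
  disjoint (v∈map , v∈prod)
    with y , y∈ys , refl ← ∈-map⁻ (f x) v∈map
    with w , z , w∈xs , z∈ys , eq ← ∈-cartesianProductWith⁻ f xs ys v∈prod
    = All.lookup x∉xs w∈xs (proj₁ (inj (here refl) (there w∈xs) y∈ys z∈ys eq))

-- The list is explicit so that p can be inferred from it by unification.
∈-filterᵇ⁺ : ∀ (p : A → Bool) xs {x} → x ∈ xs → T (p x) → x ∈ filterᵇ p xs
∈-filterᵇ⁺ p _ = ∈-filter⁺ (T? ∘ p)

∈-filterᵇ⁻ : ∀ (p : A → Bool) xs {x} → x ∈ filterᵇ p xs → x ∈ xs × T (p x)
∈-filterᵇ⁻ p _ = ∈-filter⁻ (T? ∘ p)

≤-maxList : ∀ {x xs} → x ∈ xs → x ≤ maxList xs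
≤-maxList (here refl)             = m≤m⊔n _ _
≤-maxList {xs = y ∷ _} (there x∈) = ≤-trans (≤-maxList x∈) (m≤n⊔m y _)

maxList-≤ : ∀ {xs} → All (_≤ c) xs → maxList xs ≤ c
maxList-≤ = foldr-preservesᵇ ⊔-lub z≤n

∣-nonZero : .{{NonZero n}} → m ∣ n → NonZero m
∣-nonZero {n} {zero}  0∣n = contradiction (0∣⇒≡0 0∣n) (≢-nonZero⁻¹ n)
∣-nonZero {n} {suc m} _   = _

coprime-∣ : Coprime a b → c ∣ a → d ∣ b → Coprime c d
coprime-∣ a⊥b c∣a d∣b (t∣c , t∣d) = a⊥b (∣-trans t∣c c∣a , ∣-trans t∣d d∣b)

coprime-*ʳ : Coprime a b → Coprime a c → Coprime a (b * c)
coprime-*ʳ a⊥b a⊥c (t∣a , t∣bc) =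
  a⊥c (t∣a , coprime-divisor (coprime-∣ a⊥b t∣a ∣-refl) t∣bc)

coprime-^ʳ : Coprime a b → ∀ j → Coprime a (b ^ j)
coprime-^ʳ {a} a⊥b zero    = coprime-sym (1-coprimeTo a)
coprime-^ʳ     a⊥b (suc j) = coprime-*ʳ a⊥b (coprime-^ʳ a⊥b j)

gcd-nonZeroʳ : ∀ m n .{{_ : NonZero n}} → NonZero (gcd m n)
gcd-nonZeroʳ m n = ≢-nonZero (gcd[m,n]≢0 m n (inj₂ (≢-nonZero⁻¹ n)))

gcd-cofactors : ∀ a b .{{_ : NonZero b}} →
                ∃₂ λ a′ b′ → a ≡ a′ * gcd a b × b ≡ b′ * gcd a b × Coprime a′ b′
gcd-cofactors a b with divides a′ a≡a′g ← gcd[m,n]∣m a b | divides b′ b≡b′g ← gcd[m,n]∣n a b =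
  a′ , b′ , a≡a′g , b≡b′g ,
  GCD≡1⇒coprime (GCD-* (subst₂ (λ x y → GCD x y (1 * gcd a b)) a≡a′g b≡b′g
                                  (subst (GCD a b) (sym (*-identityˡ _)) (gcd-GCD a b))))
  where instance _ = gcd-nonZeroʳ a b

prime∤⇒coprime : Prime p → p ∤ n → Coprime p n
prime∤⇒coprime pp p∤n (t∣p , t∣n) with prime⇒irreducible pp t∣p
... | inj₁ t≡1 = t≡1
... | inj₂ refl = contradiction t∣n p∤n

∤-* : Prime p → p ∤ m → p ∤ n → p ∤ m * n
∤-* pp p∤m p∤n p∣mn = p∤n (coprime-divisor (prime∤⇒coprime pp p∤m) p∣mn)

∤-^ : Prime p → p ∤ n → ∀ j → p ∤ n ^ j
∤-^ pp p∤n zero    = nonTrivial⇒≢1 {{prime⇒nonTrivial pp}} ∘ ∣1⇒≡1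
∤-^ pp p∤n (suc j) = ∤-* pp p∤n (∤-^ pp p∤n j)

∤⇒coprime-^ : Prime p → p ∤ n → ∀ j → Coprime n (p ^ j)
∤⇒coprime-^ pp p∤n = coprime-^ʳ (coprime-sym (prime∤⇒coprime pp p∤n))

^-injectiveʳ : 1 < p → p ^ m ≡ p ^ n → m ≡ n
^-injectiveʳ {p} {m} {n} 1<p pᵐ≡pⁿ with <-cmp m n
... | tri< m<n _ _ = contradiction pᵐ≡pⁿ (<⇒≢ (^-monoʳ-< p 1<p m<n))
... | tri≈ _ m≡n _ = m≡n
... | tri> _ _ n<m = contradiction (sym pᵐ≡pⁿ) (<⇒≢ (^-monoʳ-< p 1<p n<m))

∣p^k⇒≡1⊎p∣ : Prime p → ∀ k → d ∣ p ^ k → d ≡ 1 ⊎ p ∣ d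
∣p^k⇒≡1⊎p∣ pp zero    d∣1 = inj₁ (∣1⇒≡1 d∣1)
∣p^k⇒≡1⊎p∣ {p} {d} pp (suc k) d∣pᵏ⁺¹ with p ∣? d
... | yes p∣d = inj₂ p∣d
... | no  p∤d = ∣p^k⇒≡1⊎p∣ pp k (coprime-divisor (coprime-sym (prime∤⇒coprime pp p∤d)) d∣pᵏ⁺¹)

factor-out : ∀ p .{{_ : NonTrivial p}} n .{{_ : NonZero n}} → ∃₂ λ j r → n ≡ p ^ j * r × p ∤ r
factor-out p n = go n (<-wellFounded n)
  where
  go : ∀ n .{{_ : NonZero n}} → Acc _<_ n → ∃₂ λ j r → n ≡ p ^ j * r × p ∤ r
  go n (acc rec) with p ∣? n
  ... | no  p∤n = 0 , n , sym (*-identityˡ n) , p∤n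
  ... | yes p∣n@(divides q n≡qp)
    with j , r , q≡pʲr , p∤r ← go q {{quotient≢0 p∣n}} (rec (quotient-< p∣n)) =
    suc j , r , trans n≡qp (trans (cong (_* p) q≡pʲr) (reorder (p ^ j) r p)) , p∤r
    where
    reorder : ∀ x r p → x * r * p ≡ p * x * r
    reorder = solve-∀

infix 4 _∣ᵘ_ _∣**_

_∣ᵘ_ : ℕ → ℕ → Set
t ∣ᵘ n = ∃[ u ] n ≡ t * u × Coprime t u

UnitarilyCoprime : ℕ → ℕ → Set
UnitarilyCoprime a b = ∀ {t} → t ∣ᵘ a → t ∣ᵘ b → t ≡ 1

_∣**_ : ℕ → ℕ → Set
d ∣** n = ∃[ e ] n ≡ d * e × UnitarilyCoprime d e

∣ᵘ⇒∣ : t ∣ᵘ n → t ∣ n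
∣ᵘ⇒∣ (u , refl , _) = m∣m*n u

1∣ᵘn : 1 ∣ᵘ n
1∣ᵘn {n} = n , sym (*-identityˡ n) , 1-coprimeTo n

∣ᵘ-*ʳ : t ∣ᵘ m → Coprime t n → t ∣ᵘ m * n
∣ᵘ-*ʳ {t} {n = n} (u , refl , t⊥u) t⊥n = u * n , *-assoc t u n , coprime-*ʳ t⊥u t⊥n

∣ᵘ-* : .{{NonZero n}} → Coprime u w → u ∣ᵘ n → w ∣ᵘ n → u * w ∣ᵘ n
∣ᵘ-* {n} {u} {w} u⊥w (x , refl , u⊥x) (y , ux≡wy , w⊥y)
  with divides z refl ← coprime-divisor (coprime-sym u⊥w) (divides y (trans ux≡wy (*-comm w y))) =
  z , trans (cong (u *_) (*-comm z w)) (sym (*-assoc u w z)) ,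
  coprime-sym (coprime-*ʳ (coprime-sym u⊥z) (coprime-sym w⊥z))
  where
  instance _ = ∣-nonZero (∣n⇒∣m*n u (n∣m*n z))
  u⊥z : Coprime u z
  u⊥z = coprime-∣ u⊥x ∣-refl (m∣m*n w)
  y≡u*z : y ≡ u * z
  y≡u*z = *-cancelˡ-≡ y (u * z) w (trans (sym ux≡wy) (reorder u z w))
    where
    reorder : ∀ u z w → u * (z * w) ≡ w * (u * z)
    reorder = solve-∀
  w⊥z : Coprime w z
  w⊥z = coprime-∣ w⊥y ∣-refl (divides u y≡u*z)

gcd-∣ᵘ : .{{NonZero m}} → t ∣ᵘ m * n → gcd t m ∣ᵘ m
gcd-∣ᵘ {m} {t} {n} (u , mn≡tu , t⊥u) with h , m′ , t≡hg , m≡m′g , h⊥m′ ← gcd-cofactors t m =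
  m′ , trans m≡m′g (*-comm m′ g) , g⊥m′
  where
  g : ℕ
  g = gcd t m
  instance _ = gcd-nonZeroʳ t m
  hu≡nm′ : h * u ≡ n * m′
  hu≡nm′ = *-cancelˡ-≡ (h * u) (n * m′) g (begin
    g * (h * u)   ≡⟨ *-assoc g h u ⟨
    g * h * u     ≡⟨ cong (_* u) (trans (*-comm g h) (sym t≡hg)) ⟩
    t * u         ≡⟨ mn≡tu ⟨
    m * n         ≡⟨ cong (_* n) m≡m′g ⟩
    m′ * g * n    ≡⟨ reorder m′ g n ⟩
    g * (n * m′)  ∎)
    where
    open ≡-Reasoning
    reorder : ∀ m′ g n → m′ * g * n ≡ g * (n * m′)
    reorder = solve-∀
  g⊥m′ : Coprime g m′
  g⊥m′ (c∣g , c∣m′) =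
    t⊥u (∣-trans c∣g (gcd[m,n]∣m t m) ,
         ∣-trans c∣m′ (coprime-divisor (coprime-sym h⊥m′) (divides n hu≡nm′)))

∣-*⇒≡gcd*gcd : .{{NonZero a}} → Coprime a b → d ∣ a * b → d ≡ gcd d a * gcd d b
∣-*⇒≡gcd*gcd {a} {b} {d} a⊥b d∣ab with d′ , a′ , d≡d′g , a≡a′g , d′⊥a′ ← gcd-cofactors d a =
  trans d≡d′g (trans (*-comm d′ g) (cong (g *_) d′≡gcd[d,b]))
  where
  g : ℕ
  g = gcd d a
  instance _ = gcd-nonZeroʳ d a
  d′∣b : d′ ∣ b
  d′∣b = coprime-divisor d′⊥a′
           (*-cancelʳ-∣ g (subst₂ _∣_ d≡d′g (trans (cong (_* b) a≡a′g) (reorder a′ g b)) d∣ab))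
    where
    reorder : ∀ a′ g b → a′ * g * b ≡ a′ * b * g
    reorder = solve-∀
  gcd[d,b]∣d′ : gcd d b ∣ d′
  gcd[d,b]∣d′ = coprime-divisor (coprime-∣ (coprime-sym a⊥b) (gcd[m,n]∣n d b) (gcd[m,n]∣n d a))
                  (subst (gcd d b ∣_) (trans d≡d′g (*-comm d′ g)) (gcd[m,n]∣m d b))
  d′≡gcd[d,b] : d′ ≡ gcd d b
  d′≡gcd[d,b] = ∣-antisym (gcd-greatest (divides g (trans d≡d′g (*-comm d′ g))) d′∣b) gcd[d,b]∣d′

gcd-∣ᵘ-restrict : .{{NonZero a}} → Coprime a b → x ∣ a → y ∣ b → t ∣ᵘ x * y → gcd t a ∣ᵘ x
gcd-∣ᵘ-restrict {a} {b} {x} {y} {t} a⊥b x∣a y∣b t∣ᵘxy =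
  subst (_∣ᵘ x) gcd[t,x]≡gcd[t,a] (gcd-∣ᵘ {{∣-nonZero x∣a}} t∣ᵘxy)
  where
  t∣yx : t ∣ y * x
  t∣yx = subst (t ∣_) (*-comm x y) (∣ᵘ⇒∣ t∣ᵘxy)
  gcd[t,x]≡gcd[t,a] : gcd t x ≡ gcd t a
  gcd[t,x]≡gcd[t,a] = ∣-antisym
    (gcd-greatest (gcd[m,n]∣m t x) (∣-trans (gcd[m,n]∣n t x) x∣a))
    (gcd-greatest (gcd[m,n]∣m t a)
       (coprime-divisor (coprime-∣ a⊥b (gcd[m,n]∣n t a) y∣b) (∣-trans (gcd[m,n]∣m t a) t∣yx)))

UnitarilyCoprime-restrict : ∀ {d₁ d₂ e₁ e₂} → Coprime a b → d₁ ∣ a → e₁ ∣ a → d₂ ∣ b → e₂ ∣ b →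
                            UnitarilyCoprime (d₁ * d₂) (e₁ * e₂) → UnitarilyCoprime d₁ e₁
UnitarilyCoprime-restrict a⊥b d₁∣a e₁∣a d₂∣b e₂∣b d⊥ᵘe t∣ᵘd₁ t∣ᵘe₁ = d⊥ᵘe
  (∣ᵘ-*ʳ t∣ᵘd₁ (coprime-∣ a⊥b (∣-trans (∣ᵘ⇒∣ t∣ᵘd₁) d₁∣a) d₂∣b))
  (∣ᵘ-*ʳ t∣ᵘe₁ (coprime-∣ a⊥b (∣-trans (∣ᵘ⇒∣ t∣ᵘe₁) e₁∣a) e₂∣b))

∣**-*⁻ : .{{NonZero a}} → .{{NonZero b}} → Coprime a b → d ∣** a * b →
         ∃₂ λ d₁ d₂ → d ≡ d₁ * d₂ × d₁ ∣** a × d₂ ∣** b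
∣**-*⁻ {a} {b} {d} a⊥b (e , ab≡de , d⊥ᵘe)
  with divides e₁ a≡e₁d₁ ← gcd[m,n]∣n d a | divides e₂ b≡e₂d₂ ← gcd[m,n]∣n d b =
    d₁ , d₂ , d≡d₁d₂
  , (e₁ , trans a≡e₁d₁ (*-comm e₁ d₁) ,
     UnitarilyCoprime-restrict a⊥b d₁∣a e₁∣a d₂∣b e₂∣b d₁d₂⊥ᵘe₁e₂)
  , (e₂ , trans b≡e₂d₂ (*-comm e₂ d₂) ,
     UnitarilyCoprime-restrict (coprime-sym a⊥b) d₂∣b e₂∣b d₁∣a e₁∣a
       (subst₂ UnitarilyCoprime (*-comm d₁ d₂) (*-comm e₁ e₂) d₁d₂⊥ᵘe₁e₂))
  where
  d₁ d₂ : ℕ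
  d₁ = gcd d a
  d₂ = gcd d b
  d₁∣a : d₁ ∣ a
  d₁∣a = gcd[m,n]∣n d a
  d₂∣b : d₂ ∣ b
  d₂∣b = gcd[m,n]∣n d b
  e₁∣a : e₁ ∣ a
  e₁∣a = divides d₁ (trans a≡e₁d₁ (*-comm e₁ d₁))
  e₂∣b : e₂ ∣ b
  e₂∣b = divides d₂ (trans b≡e₂d₂ (*-comm e₂ d₂))
  d∣ab : d ∣ a * b
  d∣ab = divides e (trans ab≡de (*-comm d e))
  instance _ = ∣-nonZero {{m*n≢0 a b}} d∣ab
  d≡d₁d₂ : d ≡ d₁ * d₂
  d≡d₁d₂ = ∣-*⇒≡gcd*gcd a⊥b d∣ab
  e≡e₁e₂ : e ≡ e₁ * e₂
  e≡e₁e₂ = *-cancelˡ-≡ e (e₁ * e₂) d (begin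
    d * e              ≡⟨ ab≡de ⟨
    a * b              ≡⟨ cong₂ _*_ a≡e₁d₁ b≡e₂d₂ ⟩
    e₁ * d₁ * (e₂ * d₂)  ≡⟨ reorder e₁ d₁ e₂ d₂ ⟩
    d₁ * d₂ * (e₁ * e₂)  ≡⟨ cong (_* (e₁ * e₂)) d≡d₁d₂ ⟨
    d * (e₁ * e₂)      ∎)
    where
    open ≡-Reasoning
    reorder : ∀ e₁ d₁ e₂ d₂ → e₁ * d₁ * (e₂ * d₂) ≡ d₁ * d₂ * (e₁ * e₂)
    reorder = solve-∀
  d₁d₂⊥ᵘe₁e₂ : UnitarilyCoprime (d₁ * d₂) (e₁ * e₂)
  d₁d₂⊥ᵘe₁e₂ = subst₂ UnitarilyCoprime d≡d₁d₂ e≡e₁e₂ d⊥ᵘe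

∣**-*⁺ : .{{NonZero a}} → .{{NonZero b}} → ∀ {d₁ d₂} → Coprime a b →
         d₁ ∣** a → d₂ ∣** b → d₁ * d₂ ∣** a * b
∣**-*⁺ {a} {b} {d₁} {d₂} a⊥b (e₁ , a≡d₁e₁ , d₁⊥ᵘe₁) (e₂ , b≡d₂e₂ , d₂⊥ᵘe₂) =
  e₁ * e₂ , trans (cong₂ _*_ a≡d₁e₁ b≡d₂e₂) (interchange d₁ e₁ d₂ e₂) , d₁d₂⊥ᵘe₁e₂
  where
  d₁∣a : d₁ ∣ a
  d₁∣a = divides e₁ (trans a≡d₁e₁ (*-comm d₁ e₁))
  e₁∣a : e₁ ∣ a
  e₁∣a = divides d₁ a≡d₁e₁
  d₂∣b : d₂ ∣ b
  d₂∣b = divides e₂ (trans b≡d₂e₂ (*-comm d₂ e₂))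
  e₂∣b : e₂ ∣ b
  e₂∣b = divides d₂ b≡d₂e₂
  d₁d₂⊥ᵘe₁e₂ : UnitarilyCoprime (d₁ * d₂) (e₁ * e₂)
  d₁d₂⊥ᵘe₁e₂ {t} t∣ᵘd t∣ᵘe = begin
    t                  ≡⟨ ∣-*⇒≡gcd*gcd a⊥b (∣-trans (∣ᵘ⇒∣ t∣ᵘd) (*-pres-∣ d₁∣a d₂∣b)) ⟩
    gcd t a * gcd t b  ≡⟨ cong₂ _*_ gcd[t,a]≡1 gcd[t,b]≡1 ⟩
    1                  ∎
    where
    open ≡-Reasoning
    gcd[t,a]≡1 : gcd t a ≡ 1
    gcd[t,a]≡1 = d₁⊥ᵘe₁ (gcd-∣ᵘ-restrict a⊥b d₁∣a d₂∣b t∣ᵘd) (gcd-∣ᵘ-restrict a⊥b e₁∣a e₂∣b t∣ᵘe)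
    gcd[t,b]≡1 : gcd t b ≡ 1
    gcd[t,b]≡1 = d₂⊥ᵘe₂
      (gcd-∣ᵘ-restrict (coprime-sym a⊥b) d₂∣b d₁∣a (subst (t ∣ᵘ_) (*-comm d₁ d₂) t∣ᵘd))
      (gcd-∣ᵘ-restrict (coprime-sym a⊥b) e₂∣b e₁∣a (subst (t ∣ᵘ_) (*-comm e₁ e₂) t∣ᵘe))

∣**⇒∣ : d ∣** n → d ∣ n
∣**⇒∣ (e , refl , _) = m∣m*n e

n∣**n : n ∣** n
n∣**n {n} = 1 , sym (*-identityʳ n) , λ _ t∣ᵘ1 → ∣1⇒≡1 (∣ᵘ⇒∣ t∣ᵘ1)

*-injective-coprime : .{{NonZero m}} → Coprime m n → w ∣ m → x ∣ m → y ∣ n → u ∣ n →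
                      w * y ≡ x * u → w ≡ x × y ≡ u
*-injective-coprime {w = w} {x} {y} {u} m⊥n w∣m x∣m y∣n u∣n wy≡xu = w≡x , y≡u
  where
  w∣x : w ∣ x
  w∣x = coprime-divisor (coprime-∣ m⊥n w∣m u∣n) (subst (w ∣_) (trans wy≡xu (*-comm x u)) (m∣m*n y))
  x∣w : x ∣ w
  x∣w = coprime-divisor (coprime-∣ m⊥n x∣m y∣n) (subst (x ∣_) (trans (sym wy≡xu) (*-comm w y)) (m∣m*n u))
  w≡x : w ≡ x
  w≡x = ∣-antisym w∣x x∣w
  y≡u : y ≡ u
  y≡u = *-cancelˡ-≡ y u w {{∣-nonZero w∣m}} (trans wy≡xu (cong (_* u) (sym w≡x)))

∈-divisors⁺ : .{{NonZero n}} → d ∣ n → d ∈ divisors n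
∈-divisors⁺ {n} {zero}  0∣n = contradiction (0∣⇒≡0 0∣n) (≢-nonZero⁻¹ n)
∈-divisors⁺ {n} {suc k} d∣n =
  ∈-filterᵇ⁺ _ (map suc (upTo n)) (∈-map⁺ suc (∈-upTo⁺ (∣⇒≤ d∣n))) (fromWitness {a? = suc k ∣? n} d∣n)

∈-divisors⁻ : d ∈ divisors n → d ∣ n
∈-divisors⁻ {d} {n} d∈ = toWitness {a? = d ∣? n} (proj₂ (∈-filterᵇ⁻ _ (map suc (upTo n)) d∈))

divisors-unique : ∀ n → Unique (divisors n)
divisors-unique n = Unique.filter⁺ _ (Unique.map⁺ suc-injective (Unique.upTo⁺ n))

isUnitaryDivisorᵇ⁺ : .{{NonZero n}} → t ∣ᵘ n → T (isUnitaryDivisorᵇ t n)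
isUnitaryDivisorᵇ⁺ {n} {zero}    (u , n≡0 , _)     = contradiction n≡0 (≢-nonZero⁻¹ n)
isUnitaryDivisorᵇ⁺ {n} {t@(suc _)} (u , n≡tu , t⊥u) = from T-∧ (fromWitness {a? = t ∣? n} t∣n ,
  ≡⇒≡ᵇ _ 1 (trans (cong (gcd t) (n/m≡quotient t∣n)) (coprime⇒gcd≡1 t⊥u)))
  where
  t∣n : t ∣ n
  t∣n = divides u (trans n≡tu (*-comm t u))

isUnitaryDivisorᵇ⁻ : .{{NonZero n}} → T (isUnitaryDivisorᵇ t n) → t ∣ᵘ n
isUnitaryDivisorᵇ⁻ {n} {zero} T[0∣ᵘn] =
  contradiction (0∣⇒≡0 (toWitness {a? = 0 ∣? n} (proj₁ (to T-∧ T[0∣ᵘn])))) (≢-nonZero⁻¹ n)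
isUnitaryDivisorᵇ⁻ {n} {t@(suc _)} T[t∣ᵘn]
  with T[t∣n] , T[gcd≡1] ← to T-∧ T[t∣ᵘn]
  with t∣n@(divides u n≡ut) ← toWitness {a? = t ∣? n} T[t∣n] =
  u , trans n≡ut (*-comm u t) ,
  gcd≡1⇒coprime (trans (cong (gcd t) (sym (n/m≡quotient t∣n))) (≡ᵇ⇒≡ _ 1 T[gcd≡1]))

∈-commonUnitaryDivisors : .{{NonZero a}} → .{{NonZero b}} →
  t ∈ filterᵇ (λ t → isUnitaryDivisorᵇ t b) (unitaryDivisors a) ⇔ (t ∣ᵘ a × t ∣ᵘ b)
∈-commonUnitaryDivisors {a} {b} = mk⇔
  (λ t∈ → let t∈ᵤ , T[t∣ᵘb] = ∈-filterᵇ⁻ _ (unitaryDivisors a) t∈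
          in isUnitaryDivisorᵇ⁻ (proj₂ (∈-filterᵇ⁻ _ (divisors a) t∈ᵤ)) ,
             isUnitaryDivisorᵇ⁻ T[t∣ᵘb])
  (λ (t∣ᵘa , t∣ᵘb) → ∈-filterᵇ⁺ _ (unitaryDivisors a)
     (∈-filterᵇ⁺ _ (divisors a) (∈-divisors⁺ (∣ᵘ⇒∣ t∣ᵘa)) (isUnitaryDivisorᵇ⁺ t∣ᵘa))
     (isUnitaryDivisorᵇ⁺ t∣ᵘb))

gcud≡1⇔ : .{{NonZero a}} → .{{NonZero b}} → gcud a b ≡ 1 ⇔ UnitarilyCoprime a b
gcud≡1⇔ {a} {b} = mk⇔
  (λ gcud≡1 {t} t∣ᵘa t∣ᵘb → ≤-antisym
     (subst (_ ≤_) gcud≡1 (≤-maxList (from ∈-commonUnitaryDivisors (t∣ᵘa , t∣ᵘb))))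
     (>-nonZero⁻¹ t {{∣-nonZero (∣ᵘ⇒∣ t∣ᵘa)}}))
  (λ a⊥ᵘb → ≤-antisym
     (maxList-≤ (All.tabulate λ t∈ →
        let t∣ᵘa , t∣ᵘb = to ∈-commonUnitaryDivisors t∈ in ≤-reflexive (a⊥ᵘb t∣ᵘa t∣ᵘb)))
     (≤-maxList (from ∈-commonUnitaryDivisors (1∣ᵘn , 1∣ᵘn))))

∈-biunitaryDivisors⁺ : .{{NonZero n}} → d ∣** n → d ∈ biunitaryDivisors n
∈-biunitaryDivisors⁺ {n} {zero}    (e , n≡0 , _) = contradiction n≡0 (≢-nonZero⁻¹ n)
∈-biunitaryDivisors⁺ {n} {d@(suc _)} (e , n≡de , d⊥ᵘe) =
  ∈-filterᵇ⁺ _ (divisors n) (∈-divisors⁺ d∣n)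
    (≡⇒≡ᵇ _ 1 (trans (cong (gcud d) (n/m≡quotient d∣n)) (from gcud≡1⇔ d⊥ᵘe)))
  where
  d∣n : d ∣ n
  d∣n = divides e (trans n≡de (*-comm d e))
  instance _ = ∣-nonZero (divides d n≡de)

∈-biunitaryDivisors⁻ : .{{NonZero n}} → d ∈ biunitaryDivisors n → d ∣** n
∈-biunitaryDivisors⁻ {n} {d} d∈ with ∈-filterᵇ⁻ _ (divisors n) d∈
∈-biunitaryDivisors⁻ {n} {zero}    _ | 0∈ , _ = contradiction (0∣⇒≡0 (∈-divisors⁻ 0∈)) (≢-nonZero⁻¹ n)
∈-biunitaryDivisors⁻ {n} {d@(suc _)} _ | d∈ , T[gcud≡1] with d∣n@(divides e n≡ed) ← ∈-divisors⁻ d∈ =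
  e , trans n≡ed (*-comm e d) ,
  to gcud≡1⇔ (trans (cong (gcud d) (sym (n/m≡quotient d∣n))) (≡ᵇ⇒≡ _ 1 T[gcud≡1]))
  where instance _ = ∣-nonZero (divides d (trans n≡ed (*-comm e d)))

biunitaryDivisors-unique : ∀ n → Unique (biunitaryDivisors n)
biunitaryDivisors-unique n = Unique.filter⁺ _ (divisors-unique n)

σ**-*-nonZero : .{{NonZero m}} → .{{NonZero n}} → Coprime m n → σ** (m * n) ≡ σ** m * σ** n
σ**-*-nonZero {m} {n} m⊥n = begin
  σ** (m * n)    ≡⟨ ≤-antisym (sum-mono-⊆ (biunitaryDivisors-unique (m * n)) ⊆products)
                              (sum-mono-⊆ products-unique products⊆) ⟩
  sum products   ≡⟨ sum-cartesianProductWith-* (biunitaryDivisors m) (biunitaryDivisors n) ⟩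
  σ** m * σ** n  ∎
  where
  open ≡-Reasoning
  instance _ = m*n≢0 m n
  products : List ℕ
  products = cartesianProductWith _*_ (biunitaryDivisors m) (biunitaryDivisors n)
  ⊆products : biunitaryDivisors (m * n) ⊆ products
  ⊆products d∈ =
    let d₁ , d₂ , d≡d₁d₂ , d₁∣**m , d₂∣**n = ∣**-*⁻ m⊥n (∈-biunitaryDivisors⁻ d∈) in
    subst (_∈ products) (sym d≡d₁d₂)
      (∈-cartesianProductWith⁺ _*_ (∈-biunitaryDivisors⁺ d₁∣**m) (∈-biunitaryDivisors⁺ d₂∣**n))
  products⊆ : products ⊆ biunitaryDivisors (m * n)
  products⊆ d∈ =
    let d₁ , d₂ , d₁∈ , d₂∈ , d≡d₁d₂ =
          ∈-cartesianProductWith⁻ _*_ (biunitaryDivisors m) (biunitaryDivisors n) d∈ in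
    subst (_∈ biunitaryDivisors (m * n)) (sym d≡d₁d₂)
      (∈-biunitaryDivisors⁺ (∣**-*⁺ m⊥n (∈-biunitaryDivisors⁻ d₁∈) (∈-biunitaryDivisors⁻ d₂∈)))
  products-unique : Unique products
  products-unique = Unique-cartesianProductWith⁺-local _*_ {biunitaryDivisors m} {biunitaryDivisors n}
    (λ w∈ x∈ y∈ u∈ → *-injective-coprime m⊥n
       (∣**⇒∣ (∈-biunitaryDivisors⁻ w∈)) (∣**⇒∣ (∈-biunitaryDivisors⁻ x∈))
       (∣**⇒∣ (∈-biunitaryDivisors⁻ y∈)) (∣**⇒∣ (∈-biunitaryDivisors⁻ u∈)))
    (biunitaryDivisors-unique m) (biunitaryDivisors-unique n)

σ**-* : Coprime m n → σ** (m * n) ≡ σ** m * σ** n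
σ**-* {zero}          _   = refl
σ**-* {suc m} {zero}  _   = trans (cong σ** (*-zeroʳ (suc m))) (sym (*-zeroʳ (σ** (suc m))))
σ**-* {suc _} {suc _} m⊥n = σ**-*-nonZero m⊥n

sum≤σ** : .{{NonZero n}} → ∀ {ds} → Unique ds → All (_∣** n) ds → sum ds ≤ σ** n
sum≤σ** ds! ds∣**n = sum-mono-⊆ ds! (∈-biunitaryDivisors⁺ ∘ All.lookup ds∣**n)

n≤σ**n : .{{NonZero n}} → n ≤ σ** n
n≤σ**n {n} = ≤-trans (≤-reflexive (sym (+-identityʳ n))) (sum≤σ** ([] ∷ []) (n∣**n ∷ []))

∣ᵘp^k⇒≡1⊎≡p^k : Prime p → ∀ k → t ∣ᵘ p ^ k → t ≡ 1 ⊎ t ≡ p ^ k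
∣ᵘp^k⇒≡1⊎≡p^k {p} {t} pp k (u , pᵏ≡tu , t⊥u)
  with ∣p^k⇒≡1⊎p∣ pp k (divides u (trans pᵏ≡tu (*-comm t u))) | ∣p^k⇒≡1⊎p∣ pp k (divides t pᵏ≡tu)
... | inj₁ t≡1 | _         = inj₁ t≡1
... | inj₂ _   | inj₁ refl = inj₂ (sym (trans pᵏ≡tu (*-identityʳ t)))
... | inj₂ p∣t | inj₂ p∣u  = contradiction (t⊥u (p∣t , p∣u)) (nonTrivial⇒≢1 {{prime⇒nonTrivial pp}})

p^k∣**p^a : Prime p → k ≤ a → 2 * k ≢ a → p ^ k ∣** p ^ a
p^k∣**p^a {p} {k} {a} pp k≤a 2k≢a = p ^ (a ∸ k) , pᵃ≡pᵏpᵃ⁻ᵏ , pᵏ⊥ᵘpᵃ⁻ᵏ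
  where
  pᵃ≡pᵏpᵃ⁻ᵏ : p ^ a ≡ p ^ k * p ^ (a ∸ k)
  pᵃ≡pᵏpᵃ⁻ᵏ = trans (cong (p ^_) (sym (m+[n∸m]≡n k≤a))) (^-distribˡ-+-* p k (a ∸ k))
  pᵏ⊥ᵘpᵃ⁻ᵏ : UnitarilyCoprime (p ^ k) (p ^ (a ∸ k))
  pᵏ⊥ᵘpᵃ⁻ᵏ t∣ᵘpᵏ t∣ᵘpᵃ⁻ᵏ with ∣ᵘp^k⇒≡1⊎≡p^k pp k t∣ᵘpᵏ | ∣ᵘp^k⇒≡1⊎≡p^k pp (a ∸ k) t∣ᵘpᵃ⁻ᵏ
  ... | inj₁ t≡1   | _            = t≡1
  ... | inj₂ _     | inj₁ t≡1     = t≡1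
  ... | inj₂ t≡pᵏ  | inj₂ t≡pᵃ⁻ᵏ = contradiction 2k≡a 2k≢a
    where
    open ≡-Reasoning
    k≡a∸k : k ≡ a ∸ k
    k≡a∸k = ^-injectiveʳ {m = k} {a ∸ k} (nonTrivial⇒n>1 p {{prime⇒nonTrivial pp}})
              (trans (sym t≡pᵏ) t≡pᵃ⁻ᵏ)
    2k≡a : 2 * k ≡ a
    2k≡a = begin
      k + (k + 0)  ≡⟨ cong (k +_) (trans (+-identityʳ k) k≡a∸k) ⟩
      k + (a ∸ k)  ≡⟨ m+[n∸m]≡n k≤a ⟩
      a            ∎

σ**[p^[j+b]]≥ : Prime p → j < b → p ^ b * sum (map (p ^_) (upTo (suc j))) ≤ σ** (p ^ (j + b))
σ**[p^[j+b]]≥ {p} {j} {b} pp j<b = begin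
  p ^ b * sum (map (p ^_) is)            ≡⟨ sum-map-*ˡ (p ^ b) (map (p ^_) is) ⟨
  sum (map (p ^ b *_) (map (p ^_) is))   ≡⟨ cong sum (map-∘ is) ⟨
  sum (map (λ i → p ^ b * p ^ i) is)     ≡⟨ cong sum (map-cong (^-distribˡ-+-* p b) is) ⟨
  sum (map (λ i → p ^ (b + i)) is)       ≤⟨ sum≤σ** unique (All-map⁺ (All.tabulate (biunitary ∘ ∈-upTo⁻))) ⟩
  σ** (p ^ (j + b))                      ∎
  where
  open ≤-Reasoning
  instance
    _ = prime⇒nonTrivial pp
    _ = m^n≢0 p (j + b) {{prime⇒nonZero pp}}
  is : List ℕ
  is = upTo (suc j)
  unique : Unique (map (λ i → p ^ (b + i)) is)
  unique = Unique.map⁺ (+-cancelˡ-≡ b _ _ ∘ ^-injectiveʳ (nonTrivial⇒n>1 p)) (Unique.upTo⁺ (suc j))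
  biunitary : ∀ {i} → i < suc j → p ^ (b + i) ∣** p ^ (j + b)
  biunitary {i} (s≤s i≤j) = p^k∣**p^a pp
    (≤-trans (+-monoʳ-≤ b i≤j) (≤-reflexive (+-comm b j)))
    (>⇒≢ (begin-strict
      j + b              <⟨ +-monoˡ-< b j<b ⟩
      b + b              ≤⟨ +-mono-≤ (m≤m+n b i) (≤-trans (m≤m+n b i) (m≤m+n (b + i) 0)) ⟩
      2 * (b + i)        ∎))

record AbundancyAtLeast (n a b : ℕ) : Set where
  constructor abundancy≥
  field cross-multiplied : a * n ≤ b * σ** n

abundancy-* : Coprime m n → AbundancyAtLeast m a b → AbundancyAtLeast n c d →
              AbundancyAtLeast (m * n) (a * c) (b * d)
abundancy-* {m} {n} {a} {b} {c} {d} m⊥n (abundancy≥ am≤bσm) (abundancy≥ cn≤dσn) = abundancy≥ (begin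
  a * c * (m * n)          ≡⟨ interchange a c m n ⟩
  a * m * (c * n)          ≤⟨ *-mono-≤ am≤bσm cn≤dσn ⟩
  b * σ** m * (d * σ** n)  ≡⟨ interchange b (σ** m) d (σ** n) ⟩
  b * d * (σ** m * σ** n)  ≡⟨ cong (b * d *_) (σ**-* m⊥n) ⟨
  b * d * σ** (m * n)      ∎)
  where open ≤-Reasoning

abundancy-p^j : Prime p → 1 ≤ j → j ≢ 2 → AbundancyAtLeast (p ^ j) (1 + p) p
abundancy-p^j {p} {suc i} pp _ 1+i≢2 = abundancy≥ (begin
  (1 + p) * p ^ suc i            ≡⟨ reorder p (p ^ i) ⟩
  p * (p ^ suc i + (p ^ i + 0))  ≤⟨ *-monoʳ-≤ p (sum≤σ** unique biunitary) ⟩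
  p * σ** (p ^ suc i)            ∎)
  where
  open ≤-Reasoning
  instance _ = m^n≢0 p (suc i) {{prime⇒nonZero pp}}
  reorder : ∀ p x → (1 + p) * (p * x) ≡ p * (p * x + (x + 0))
  reorder = solve-∀
  unique : Unique (p ^ suc i ∷ p ^ i ∷ [])
  unique = (1+n≢n ∘ ^-injectiveʳ {m = suc i} {i} (nonTrivial⇒n>1 p {{prime⇒nonTrivial pp}}) ∷ []) ∷ [] ∷ []
  2i≢1+i : 2 * i ≢ suc i
  2i≢1+i 2i≡1+i = 1+i≢2 (cong suc (+-cancelˡ-≡ i i 1 (begin-equality
    i + i        ≡⟨ cong (i +_) (+-identityʳ i) ⟨
    2 * i        ≡⟨ 2i≡1+i ⟩
    suc i        ≡⟨ +-comm 1 i ⟩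
    i + 1        ∎)))
  biunitary : All (_∣** p ^ suc i) (p ^ suc i ∷ p ^ i ∷ [])
  biunitary = n∣**n ∷ p^k∣**p^a pp (n≤1+n i) 2i≢1+i ∷ []

-- e = 8 is the worst case (495/256); for e ≥ 9 the exponents e - 4, …, e all exceed e/2.
abundancy-2^[7+c] : ∀ c → AbundancyAtLeast (2 ^ (7 + c)) 247 128
abundancy-2^[7+c] 0             = abundancy≥ (≤ᵇ⇒≤ _ _ _)
abundancy-2^[7+c] 1             = abundancy≥ (≤ᵇ⇒≤ _ _ _)
abundancy-2^[7+c] (suc (suc c)) = abundancy≥ (begin
  247 * 2 ^ (9 + c)         ≡⟨ lhs (2 ^ (5 + c)) ⟩
  3952 * 2 ^ (5 + c)        ≤⟨ *-monoˡ-≤ (2 ^ (5 + c)) (≤ᵇ⇒≤ 3952 3968 _) ⟩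
  3968 * 2 ^ (5 + c)        ≡⟨ rhs (2 ^ (5 + c)) ⟩
  128 * (2 ^ (5 + c) * 31)  ≤⟨ *-monoʳ-≤ 128 (σ**[p^[j+b]]≥ prime[2] (m≤m+n 5 c)) ⟩
  128 * σ** (2 ^ (9 + c))   ∎)
  where
  open ≤-Reasoning
  lhs : ∀ x → 247 * (2 * (2 * (2 * (2 * x)))) ≡ 3952 * x
  lhs = solve-∀
  rhs : ∀ x → 3968 * x ≡ 128 * (x * 31)
  rhs = solve-∀

abundancy-2^e : ∀ {e} → 7 ≤ e → AbundancyAtLeast (2 ^ e) 247 128
abundancy-2^e (s≤s (s≤s (s≤s (s≤s (s≤s (s≤s (s≤s {n = c} _))))))) = abundancy-2^[7+c] c

unitary-abundancy-≤ : .{{NonZero n}} → σ** n ≡ k * n → u ∣ᵘ n → AbundancyAtLeast u a b → a ≤ k * b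
unitary-abundancy-≤ {n} {k} {u} {a} {b} σn≡kn (v , refl , u⊥v) (abundancy≥ au≤bσu) =
  *-cancelʳ-≤ a (k * b) (u * v) (begin
    a * (u * v)          ≡⟨ *-assoc a u v ⟨
    a * u * v            ≤⟨ *-monoˡ-≤ v au≤bσu ⟩
    b * σ** u * v        ≤⟨ *-monoʳ-≤ (b * σ** u) (n≤σ**n {{m*n≢0⇒n≢0 u}}) ⟩
    b * σ** u * σ** v    ≡⟨ *-assoc b (σ** u) (σ** v) ⟩
    b * (σ** u * σ** v)  ≡⟨ cong (b *_) (trans (sym (σ**-* u⊥v)) σn≡kn) ⟩
    b * (k * (u * v))    ≡⟨ *-assoc b k (u * v) ⟨
    b * k * (u * v)      ≡⟨ cong (_* (u * v)) (*-comm b k) ⟩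
    k * b * (u * v)      ∎)
  where open ≤-Reasoning

prime-power-∣ᵘ : Prime p → ∀ j → n ≡ p ^ j * m → p ∤ m → p ^ j ∣ᵘ n
prime-power-∣ᵘ pp j n≡pʲm p∤m = _ , n≡pʲm , coprime-sym (∤⇒coprime-^ pp p∤m j)

∥⇒∣ᵘ : Prime p → p ^ j ∥ n → p ^ j ∣ᵘ n
∥⇒∣ᵘ {p} {j} {n} pp (divides q n≡qpʲ , pʲ⁺¹∤n) = prime-power-∣ᵘ pp j (trans n≡qpʲ (*-comm q (p ^ j))) p∤q
  where
  p∤q : p ∤ q
  p∤q p∣q = pʲ⁺¹∤n (subst (p ^ suc j ∣_) (sym n≡qpʲ) (*-monoˡ-∣ (p ^ j) p∣q))

∣ᵘ-extend : .{{NonZero n}} → Prime p → u ∣ᵘ n → p ∤ u → p ∣ n → ∃[ j ] 1 ≤ j × u * p ^ j ∣ᵘ n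
∣ᵘ-extend {n} {p} pp u∣ᵘn p∤u p∣n
  with j , r , n≡pʲr , p∤r ← factor-out p {{prime⇒nonTrivial pp}} n =
  j , n≢0⇒n>0 j≢0 , ∣ᵘ-* (∤⇒coprime-^ pp p∤u j) u∣ᵘn (prime-power-∣ᵘ pp j n≡pʲr p∤r)
  where
  j≢0 : j ≢ 0
  j≢0 refl = p∤r (subst (p ∣_) (trans n≡pʲr (*-identityˡ r)) p∣n)

∣σ**[unitary]⇒∣ : .{{NonZero n}} → σ** n ≡ k * n → Prime p → p ∤ k → u ∣ᵘ n → p ∣ σ** u → p ∣ n
∣σ**[unitary]⇒∣ {p = p} σn≡kn pp p∤k (v , refl , u⊥v) p∣σu =
  coprime-divisor (prime∤⇒coprime pp p∤k)
    (subst (p ∣_) (trans (sym (σ**-* u⊥v)) σn≡kn) (∣m⇒∣m*n _ p∣σu))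

module Descent {n k} .{{_ : NonZero n}} (σ**n≡kn : σ** n ≡ k * n)
               {m a b} (m-abundancy : AbundancyAtLeast m a b) where

  UnitaryExtension : ℕ → ℕ → Set
  UnitaryExtension c s = m * c ∣ᵘ n × σ** (m * c) ≡ σ** m * s

  extension-abundancy : UnitaryExtension c s → AbundancyAtLeast (m * c) (a * s) (b * c)
  extension-abundancy {c} {s} (_ , σ[mc]≡σm*s) = abundancy≥ (begin
    a * s * (m * c)      ≡⟨ interchange a s m c ⟩
    a * m * (s * c)      ≤⟨ *-monoˡ-≤ (s * c) (AbundancyAtLeast.cross-multiplied m-abundancy) ⟩
    b * σ** m * (s * c)  ≡⟨ reorder b (σ** m) s c ⟩
    b * c * (σ** m * s)  ≡⟨ cong (b * c *_) σ[mc]≡σm*s ⟨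
    b * c * σ** (m * c)  ∎)
    where
    open ≤-Reasoning
    reorder : ∀ b σ s c → b * σ * (s * c) ≡ b * c * (σ * s)
    reorder = solve-∀

  extension-≤ : UnitaryExtension c s → a * s ≤ k * (b * c)
  extension-≤ ext = unitary-abundancy-≤ {k = k} σ**n≡kn (proj₁ ext) (extension-abundancy ext)

  -- For p^j ∥ n with j ≢ 2 the factor σ**(p^j)/p^j ≥ (1 + p)/p would push the abundancy past k.
  square-∣ᵘ : Prime p → p ∣ s → p ∤ k → p ∤ m * c → k * (b * c * p) < a * s * (1 + p) →
              UnitaryExtension c s → m * c * p ^ 2 ∣ᵘ n
  square-∣ᵘ {p} {s} {c} pp p∣s p∤k p∤mc bound ext@(mc∣ᵘn , σ[mc]≡σm*s)
    with j , 1≤j , mcpʲ∣ᵘn ← ∣ᵘ-extend pp mc∣ᵘn p∤mc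
           (∣σ**[unitary]⇒∣ σ**n≡kn pp p∤k mc∣ᵘn (subst (p ∣_) (sym σ[mc]≡σm*s) (∣n⇒∣m*n (σ** m) p∣s)))
    with j ≟ 2
  ... | yes refl = mcpʲ∣ᵘn
  ... | no  j≢2  = contradiction
    (unitary-abundancy-≤ {k = k} σ**n≡kn mcpʲ∣ᵘn
      (abundancy-* (∤⇒coprime-^ pp p∤mc j) (extension-abundancy ext) (abundancy-p^j pp 1≤j j≢2)))
    (<⇒≱ bound)

  extend-by-square : Prime p → p ∣ s → p ∤ k → p ∤ m → p ∤ c → k * (b * c * p) < a * s * (1 + p) →
                     UnitaryExtension c s → UnitaryExtension (c * p ^ 2) (s * σ** (p ^ 2))
  extend-by-square {p} {s} {c} pp p∣s p∤k p∤m p∤c bound ext@(_ , σ[mc]≡σm*s) =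
    subst (_∣ᵘ n) (*-assoc m c (p ^ 2)) (square-∣ᵘ pp p∣s p∤k p∤mc bound ext) ,
    (begin
      σ** (m * (c * p ^ 2))      ≡⟨ cong σ** (*-assoc m c (p ^ 2)) ⟨
      σ** (m * c * p ^ 2)        ≡⟨ σ**-* (∤⇒coprime-^ pp p∤mc 2) ⟩
      σ** (m * c) * σ** (p ^ 2)  ≡⟨ cong (_* σ** (p ^ 2)) σ[mc]≡σm*s ⟩
      σ** m * s * σ** (p ^ 2)    ≡⟨ *-assoc (σ** m) s (σ** (p ^ 2)) ⟩
      σ** m * (s * σ** (p ^ 2))  ∎)
    where
    open ≡-Reasoning
    p∤mc : p ∤ m * c
    p∤mc = ∤-* pp p∤m p∤c

lemma3p4 : (N e f : ℕ) → 0 < N → σ** N ≡ 3 * N →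
    2 ^ e ∥ N → 3 ^ f ∥ N → ¬ (e ≥ 7 × f ≡ 3)
lemma3p4 N e f 0<N σN≡3N 2^e∥N 3^f∥N (e≥7 , refl) = <⇒≱ (≤ᵇ⇒≤ _ _ _) (extension-≤ ext₃)
  where
  instance _ = >-nonZero 0<N
  open Descent {N} {3} σN≡3N {2 ^ e} {247} {128} (abundancy-2^e e≥7)

  2^e⊥27 : Coprime (2 ^ e) 27
  2^e⊥27 = coprime-sym (∤⇒coprime-^ prime[2] (from-no (2 ∣? 27)) e)

  odd∤2^e : Prime p → p ∤ 2 → p ∤ 2 ^ e
  odd∤2^e pp p∤2 = ∤-^ pp p∤2 e

  ext₀ : UnitaryExtension 27 40
  ext₀ = ∣ᵘ-* 2^e⊥27 (∥⇒∣ᵘ {j = e} prime[2] 2^e∥N) (∥⇒∣ᵘ {j = 3} (from-yes (prime? 3)) 3^f∥N) ,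
         σ**-* 2^e⊥27

  ext₁ : UnitaryExtension (27 * 5 ^ 2) (40 * σ** (5 ^ 2))
  ext₁ = extend-by-square (from-yes (prime? 5)) (from-yes (5 ∣? 40)) (from-no (5 ∣? 3))
           (odd∤2^e (from-yes (prime? 5)) (from-no (5 ∣? 2))) (from-no (5 ∣? 27)) (≤ᵇ⇒≤ _ _ _) ext₀

  ext₂ : UnitaryExtension (27 * 5 ^ 2 * 13 ^ 2) (40 * σ** (5 ^ 2) * σ** (13 ^ 2))
  ext₂ = extend-by-square (from-yes (prime? 13)) (from-yes (13 ∣? 40 * σ** (5 ^ 2))) (from-no (13 ∣? 3))
           (odd∤2^e (from-yes (prime? 13)) (from-no (13 ∣? 2))) (from-no (13 ∣? 27 * 5 ^ 2))
           (≤ᵇ⇒≤ _ _ _) ext₁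

  ext₃ : UnitaryExtension (27 * 5 ^ 2 * 13 ^ 2 * 17 ^ 2) (40 * σ** (5 ^ 2) * σ** (13 ^ 2) * σ** (17 ^ 2))
  ext₃ = extend-by-square (from-yes (prime? 17)) (from-yes (17 ∣? 40 * σ** (5 ^ 2) * σ** (13 ^ 2)))
           (from-no (17 ∣? 3)) (odd∤2^e (from-yes (prime? 17)) (from-no (17 ∣? 2)))
           (from-no (17 ∣? 27 * 5 ^ 2 * 13 ^ 2)) (≤ᵇ⇒≤ _ _ _) ext₂
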